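{- For $n\ge0$ let $\mathcal{R}_n$ be the set of restricted growth functions of length $n$ of the form $\alpha=1B_12B_2\ldots kB_k$ (with $k=\max\alpha$) such that for each $i\in[k]$ either $B_i$ is empty or $B_i=b_i$ is a single letter with $b_i\le i$. Let $r_n(q)$ be the coefficient of $x^n$ in $R(q,x)=\sum_{k\ge0}(qx)^k(1+x)(1+2x)\cdots(1+kx)$. Then $r_n(q)=\sum_{\alpha\in\mathcal{R}_n}q^{\max\alpha}$.
   Context: A restricted growth function is a word $\alpha=a_1\ldots a_n$ of positive integers (possibly empty) with $a_1=1$ and $a_{i+1}\le1+\max(a_1\ldots a_i)$ for all $i\in[n-1]$; every such word with maximum $k$ factors uniquely as $1B_12B_2\ldots kB_k$ where the displayed letters $1,\dots,k$ are the leftmost occurrences of these values and each $B_i$ is a word with letters at most $i$. $\max$ of the empty word is $0$. -}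

module Defs where

open import Data.Nat using (ℕ; zero; suc; _+_; _*_; _∸_; _≤ᵇ_; _≡ᵇ_; _⊔_)
open import Data.Bool using (Bool; true; false; _∧_; if_then_else_)
open import Data.List using (List; []; _∷_; map; concatMap; foldr; length; filter; _++_; upTo)
open import Data.Nat.ListAction using (sum)
open import Data.Bool.ListAction using (and)
open import Relation.Nullary.Decidable using (does)
open import Relation.Unary using (Decidable)
open import Data.Bool.Properties using (T?)
open import Data.Product using (_×_; _,_)

Word : Set
Word = List ℕ

maxW : Word → ℕ
maxW = foldr _⊔_ 0

-- RGF check, scanning with the current maximum m of the prefix read so far:
-- every letter a is positive and satisfies a ≤ 1 + m (for the first letter,
-- m = 0, so this forces a₁ = 1).
isRGF-from : ℕ → Word → Bool
isRGF-from m []      = true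
isRGF-from m (a ∷ w) = (1 ≤ᵇ a) ∧ (a ≤ᵇ suc m) ∧ isRGF-from (m ⊔ a) w

isRGF : Word → Bool
isRGF = isRGF-from 0

-- Factorisation α = 1 B₁ 2 B₂ … k B_k of an RGF: the list of pairs (i , B_i).
-- Scanning with current maximum m: a letter equal to m+1 is the leftmost
-- occurrence of m+1 and opens block B_{m+1}; any other letter is appended to
-- the current block.
blocks-from : ℕ → Word → List (ℕ × Word) → List (ℕ × Word)
-- accumulator: blocks already closed, in order; current block is last
blocks-from m []      acc = acc
blocks-from m (a ∷ w) acc =
  if a ≡ᵇ suc m
  then blocks-from (suc m) w (acc ++ ((suc m , []) ∷ []))
  else blocks-from m w (appendLast a acc)
  where
  appendLast : ℕ → List (ℕ × Word) → List (ℕ × Word)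
  appendLast b []                  = []
  appendLast b ((i , B) ∷ [])      = (i , B ++ (b ∷ [])) ∷ []
  appendLast b (p ∷ q ∷ ps)        = p ∷ appendLast b (q ∷ ps)

blocks : Word → List (ℕ × Word)
blocks w = blocks-from 0 w []

goodBlock : ℕ × Word → Bool
goodBlock (i , [])         = true
goodBlock (i , b ∷ [])     = b ≤ᵇ i
goodBlock (i , _ ∷ _ ∷ _)  = false

-- membership in ℛ (length handled by the enumeration below)
inR : Word → Bool
inR α = isRGF α ∧ and (map goodBlock (blocks α))

-- all words of length n over the alphabet {1,…,n}; every RGF of length n
-- has all its letters in {1,…,n}
wordsOver : ℕ → ℕ → List Word
wordsOver k zero    = [] ∷ []
wordsOver k (suc n) = concatMap (λ a → map (a ∷_) (wordsOver k n)) (map suc (upTo k))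

Rset : ℕ → List Word
Rset n = filter (λ α → T? (inR α)) (wordsOver n n)

Poly : Set
Poly = ℕ → ℕ          -- m ↦ coefficient of q^m

Series : Set
Series = ℕ → ℕ → ℕ    -- n m ↦ coefficient of x^n q^m

Σ≤ : ℕ → (ℕ → ℕ) → ℕ
Σ≤ zero    f = f 0
Σ≤ (suc n) f = Σ≤ n f + f (suc n)

_⊕_ : Series → Series → Series
(f ⊕ g) n m = f n m + g n m

_⊗_ : Series → Series → Series
(f ⊗ g) n m = Σ≤ n (λ i → Σ≤ m (λ j → f i j * g (n ∸ i) (m ∸ j)))

δ : ℕ → ℕ → ℕ
δ a b = if a ≡ᵇ b then 1 else 0

one : Series
one n m = δ n 0 * δ m 0

cx : ℕ → Series
cx c n m = c * δ n 1 * δ m 0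

qx : Series
qx n m = δ n 1 * δ m 1

_^ˢ_ : Series → ℕ → Series
f ^ˢ zero  = one
f ^ˢ suc k = (f ^ˢ k) ⊗ f

prodTerm : ℕ → Series
prodTerm zero    = one
prodTerm (suc k) = prodTerm k ⊗ (one ⊕ cx (suc k))

Rterm : ℕ → Series
Rterm k = (qx ^ˢ k) ⊗ prodTerm k

-- r_n(q) = [x^n] R(q,x).  The k-th summand is divisible by x^k, so only the
-- summands with k ≤ n contribute to the coefficient of x^n.
r : ℕ → Poly
r n m = Σ≤ n (λ k → Rterm k n m)

rhs : ℕ → Poly
rhs n m = sum (map (λ α → δ (maxW α) m) (Rset n))

-- The coefficient of x^n q^t in R(q,x) comes from the summand k = t alone and is the
-- coefficient of x^(n-t) in (1+x)(1+2x)⋯(1+tx), i.e. the elementary symmetric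
-- polynomial e_(n-t)(1,…,t).  On the other side, a word of ℛ_n with maximum t is
-- fixed by choosing which n-t of the blocks B_1,…,B_t are nonempty and a letter
-- b_i ≤ i for each of them, so there are again e_(n-t)(1,…,t) of them.
-- To count the words of the enumeration, membership in ℛ is decided by an automaton
-- whose state is the current maximum m and whether the block B_m is still vacant;
-- reading words letter by letter yields a recurrence solved by e over m, m+1, …, t.
-- The series side produces the factors in the order t, t-1, …, 1, and e is
-- invariant under permutations.

module Submission where

open import Defs
open import Data.Nat using (ℕ)
open import Relation.Binary.PropositionalEquality using (_≡_)

open import Algebra.Bundles using (CommutativeMonoid)
open import Data.Bool using (Bool; true; false; _∧_; if_then_else_)
open import Data.Bool.ListAction using (and)
open import Data.Bool.Properties using (T?; ∧-assoc; ∧-zeroʳ; ∧-commutativeMonoid)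
open import Data.List using (List; []; _∷_; _++_; _∷ʳ_; map; concatMap; filter; null; upTo; applyUpTo; applyDownFrom)
open import Data.List.Properties using (map-++; map-∘; map-cong; map-upTo; map-applyUpTo)
open import Data.List.Relation.Binary.Permutation.Propositional as ↭ using (_↭_; ↭-sym; ↭-trans; ↭-prep)
open import Data.List.Relation.Binary.Permutation.Propositional.Properties using (∷↭∷ʳ)
open import Data.Nat using (zero; suc; _+_; _*_; _∸_; _⊔_; _≤_; _<_; z≤n; s≤s; _≡ᵇ_; _≤ᵇ_)
open import Data.Nat.ListAction using (sum)
open import Data.Nat.ListAction.Properties using (sum-++)
open import Data.Nat.Properties
open import Data.Nat.Tactic.RingSolver using (solve-∀)
open import Data.Product using (_,_)
open import Function using (_∘_)
open import Relation.Binary.Definitions using (tri<; tri≈; tri>)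
open import Relation.Binary.PropositionalEquality
  using (_≢_; ≢-sym; refl; sym; trans; cong; cong₂; subst; module ≡-Reasoning)
open import Relation.Nullary using (yes; no)
open import Relation.Nullary.Decidable using (dec-true; dec-false)

open import Algebra.Properties.CommutativeSemigroup +-commutativeSemigroup
  using () renaming (interchange to +-interchange)
open import Algebra.Properties.CommutativeSemigroup *-commutativeSemigroup
  using () renaming (x∙yz≈y∙xz to *-leftComm)
open import Algebra.Properties.CommutativeSemigroup (CommutativeMonoid.commutativeSemigroup ∧-commutativeMonoid)
  using () renaming (x∙yz≈y∙xz to ∧-leftComm)

open ≡-Reasoning

[_≤_] : ℕ → ℕ → ℕ
[ zero  ≤ n     ] = 1
[ suc k ≤ zero  ] = 0
[ suc k ≤ suc n ] = [ k ≤ n ]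

[≤]≡1 : ∀ {k n} → k ≤ n → [ k ≤ n ] ≡ 1
[≤]≡1 z≤n       = refl
[≤]≡1 (s≤s k≤n) = [≤]≡1 k≤n

[≤]*-identity : ∀ {k n} → k ≤ n → ∀ x → [ k ≤ n ] * x ≡ x
[≤]*-identity k≤n x = trans (cong (_* x) ([≤]≡1 k≤n)) (*-identityˡ x)

[≤]≡0 : ∀ {k n} → n < k → [ k ≤ n ] ≡ 0
[≤]≡0 {suc k} {zero}  _         = refl
[≤]≡0 {suc k} {suc n} (s≤s n<k) = [≤]≡0 n<k

δ-refl : ∀ n → δ n n ≡ 1
δ-refl n rewrite dec-true (n ≟ n) refl = refl

δ-≢ : ∀ {m n} → m ≢ n → δ m n ≡ 0
δ-≢ {m} {n} m≢n rewrite dec-false (m ≟ n) m≢n = refl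

δ-sym : ∀ m n → δ m n ≡ δ n m
δ-sym zero    zero    = refl
δ-sym zero    (suc n) = refl
δ-sym (suc m) zero    = refl
δ-sym (suc m) (suc n) = δ-sym m n

[≤]*δ-∸ : ∀ a n b → [ a ≤ n ] * δ (n ∸ a) b ≡ δ n (a + b)
[≤]*δ-∸ zero    n       b = +-identityʳ (δ n b)
[≤]*δ-∸ (suc a) zero    b = refl
[≤]*δ-∸ (suc a) (suc n) b = [≤]*δ-∸ a n b

Σ≤-cong : ∀ n {f g : ℕ → ℕ} → (∀ i → i ≤ n → f i ≡ g i) → Σ≤ n f ≡ Σ≤ n g
Σ≤-cong zero    f≗g = f≗g 0 z≤n
Σ≤-cong (suc n) f≗g =
  cong₂ _+_ (Σ≤-cong n (λ i i≤n → f≗g i (m≤n⇒m≤1+n i≤n))) (f≗g (suc n) ≤-refl)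

Σ≤-zero : ∀ n → Σ≤ n (λ _ → 0) ≡ 0
Σ≤-zero zero    = refl
Σ≤-zero (suc n) = trans (+-identityʳ (Σ≤ n (λ _ → 0))) (Σ≤-zero n)

Σ≤-+ : ∀ n (f g : ℕ → ℕ) → Σ≤ n (λ i → f i + g i) ≡ Σ≤ n f + Σ≤ n g
Σ≤-+ zero    f g = refl
Σ≤-+ (suc n) f g rewrite Σ≤-+ n f g = +-interchange (Σ≤ n f) (Σ≤ n g) (f (suc n)) (g (suc n))

Σ≤-suc : ∀ n (f : ℕ → ℕ) → Σ≤ (suc n) f ≡ f 0 + Σ≤ n (f ∘ suc)
Σ≤-suc zero    f = refl
Σ≤-suc (suc n) f rewrite Σ≤-suc n f = +-assoc (f 0) (Σ≤ n (f ∘ suc)) (f (2 + n))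

Σ≤-reverse : ∀ n (f : ℕ → ℕ) → Σ≤ n f ≡ Σ≤ n (λ i → f (n ∸ i))
Σ≤-reverse zero    f = refl
Σ≤-reverse (suc n) f = begin
  Σ≤ n f + f (suc n)                  ≡⟨ +-comm (Σ≤ n f) (f (suc n)) ⟩
  f (suc n) + Σ≤ n f                  ≡⟨ cong (f (suc n) +_) (Σ≤-reverse n f) ⟩
  f (suc n) + Σ≤ n (λ i → f (n ∸ i))  ≡⟨ Σ≤-suc n (λ i → f (suc n ∸ i)) ⟨
  Σ≤ (suc n) (λ i → f (suc n ∸ i))    ∎

Σ≤-δ : ∀ n k (f : ℕ → ℕ) → Σ≤ n (λ i → δ i k * f i) ≡ [ k ≤ n ] * f k
Σ≤-δ zero    zero    f = refl
Σ≤-δ zero    (suc k) f = refl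
Σ≤-δ (suc n) zero    f rewrite Σ≤-suc n (λ i → δ i 0 * f i) | Σ≤-zero n = +-identityʳ (1 * f 0)
Σ≤-δ (suc n) (suc k) f = trans (Σ≤-suc n (λ i → δ i (suc k) * f i)) (Σ≤-δ n k (f ∘ suc))

Σ≤-below : ∀ n m y → m ≤ suc n → Σ≤ n (λ i → [ suc i ≤ m ] * y) ≡ m * y
Σ≤-below n       zero    y _             = Σ≤-zero n
Σ≤-below zero    (suc m) y (s≤s z≤n)     = refl
Σ≤-below (suc n) (suc m) y (s≤s m≤1+n) = begin
  Σ≤ (suc n) (λ i → [ suc i ≤ suc m ] * y)  ≡⟨ Σ≤-suc n (λ i → [ suc i ≤ suc m ] * y) ⟩
  1 * y + Σ≤ n (λ i → [ suc i ≤ m ] * y)    ≡⟨ cong₂ _+_ (*-identityˡ y) (Σ≤-below n m y m≤1+n) ⟩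
  y + m * y                                 ∎

infix 4 _≈_
_≈_ : Series → Series → Set
f ≈ g = ∀ n m → f n m ≡ g n m

⊗-cong : ∀ {f f′ g g′} → f ≈ f′ → g ≈ g′ → f ⊗ g ≈ f′ ⊗ g′
⊗-cong f≈f′ g≈g′ n m = Σ≤-cong n λ i _ → Σ≤-cong m λ j _ →
  cong₂ _*_ (f≈f′ i j) (g≈g′ (n ∸ i) (m ∸ j))

⊗-comm : ∀ f g → f ⊗ g ≈ g ⊗ f
⊗-comm f g n m = begin
  Σ≤ n (λ i → Σ≤ m (λ j → f i j * g (n ∸ i) (m ∸ j)))
    ≡⟨ Σ≤-reverse n _ ⟩
  Σ≤ n (λ i → Σ≤ m (λ j → f (n ∸ i) j * g (n ∸ (n ∸ i)) (m ∸ j)))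
    ≡⟨ Σ≤-cong n (λ i _ → Σ≤-reverse m _) ⟩
  Σ≤ n (λ i → Σ≤ m (λ j → f (n ∸ i) (m ∸ j) * g (n ∸ (n ∸ i)) (m ∸ (m ∸ j))))
    ≡⟨ Σ≤-cong n (λ i i≤n → Σ≤-cong m (λ j j≤m →
         trans (cong₂ (λ i′ j′ → f (n ∸ i) (m ∸ j) * g i′ j′) (m∸[m∸n]≡n i≤n) (m∸[m∸n]≡n j≤m))
               (*-comm (f (n ∸ i) (m ∸ j)) (g i j)))) ⟩
  Σ≤ n (λ i → Σ≤ m (λ j → g i j * f (n ∸ i) (m ∸ j)))
    ∎

⊗-distribˡ-⊕ : ∀ f g h → f ⊗ (g ⊕ h) ≈ (f ⊗ g) ⊕ (f ⊗ h)
⊗-distribˡ-⊕ f g h n m = begin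
  Σ≤ n (λ i → Σ≤ m (λ j → f i j * (g (n ∸ i) (m ∸ j) + h (n ∸ i) (m ∸ j))))
    ≡⟨ Σ≤-cong n (λ i _ → trans (Σ≤-cong m (λ j _ → *-distribˡ-+ (f i j) _ _)) (Σ≤-+ m _ _)) ⟩
  Σ≤ n (λ i → Σ≤ m (λ j → f i j * g (n ∸ i) (m ∸ j)) + Σ≤ m (λ j → f i j * h (n ∸ i) (m ∸ j)))
    ≡⟨ Σ≤-+ n _ _ ⟩
  (f ⊗ g) n m + (f ⊗ h) n m
    ∎

monomial : ℕ → ℕ → ℕ → Series
monomial c a b n m = c * δ n a * δ m b

δ*δ≈monomial : ∀ a b → (λ n m → δ n a * δ m b) ≈ monomial 1 a b
δ*δ≈monomial a b n m = cong (_* δ m b) (sym (*-identityˡ (δ n a)))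

monomial-⊗ : ∀ c a b f →
  monomial c a b ⊗ f ≈ λ n m → [ a ≤ n ] * ([ b ≤ m ] * (c * f (n ∸ a) (m ∸ b)))
monomial-⊗ c a b f n m = begin
  Σ≤ n (λ i → Σ≤ m (λ j → c * δ i a * δ j b * f (n ∸ i) (m ∸ j)))
    ≡⟨ Σ≤-cong n (λ i _ → Σ≤-cong m (λ j _ → reorder (δ j b) (δ i a) c _)) ⟩
  Σ≤ n (λ i → Σ≤ m (λ j → δ j b * (δ i a * (c * f (n ∸ i) (m ∸ j)))))
    ≡⟨ Σ≤-cong n (λ i _ → Σ≤-δ m b _) ⟩
  Σ≤ n (λ i → [ b ≤ m ] * (δ i a * (c * f (n ∸ i) (m ∸ b))))
    ≡⟨ Σ≤-cong n (λ i _ → *-leftComm [ b ≤ m ] (δ i a) _) ⟩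
  Σ≤ n (λ i → δ i a * ([ b ≤ m ] * (c * f (n ∸ i) (m ∸ b))))
    ≡⟨ Σ≤-δ n a _ ⟩
  [ a ≤ n ] * ([ b ≤ m ] * (c * f (n ∸ a) (m ∸ b)))
    ∎
  where
  reorder : ∀ x y z w → z * y * x * w ≡ x * (y * (z * w))
  reorder = solve-∀

monomial-⊗-monomial : ∀ c a b d a′ b′ →
  monomial c a b ⊗ monomial d a′ b′ ≈ monomial (c * d) (a + a′) (b + b′)
monomial-⊗-monomial c a b d a′ b′ n m = begin
  (monomial c a b ⊗ monomial d a′ b′) n m
    ≡⟨ monomial-⊗ c a b (monomial d a′ b′) n m ⟩
  [ a ≤ n ] * ([ b ≤ m ] * (c * (d * δ (n ∸ a) a′ * δ (m ∸ b) b′)))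
    ≡⟨ reorder [ a ≤ n ] [ b ≤ m ] c d (δ (n ∸ a) a′) (δ (m ∸ b) b′) ⟩
  c * d * ([ a ≤ n ] * δ (n ∸ a) a′) * ([ b ≤ m ] * δ (m ∸ b) b′)
    ≡⟨ cong₂ (λ x y → c * d * x * y) ([≤]*δ-∸ a n a′) ([≤]*δ-∸ b m b′) ⟩
  c * d * δ n (a + a′) * δ m (b + b′)
    ∎
  where
  reorder : ∀ p q c d x y → p * (q * (c * (d * x * y))) ≡ c * d * (p * x) * (q * y)
  reorder = solve-∀

⊗-identityʳ : ∀ f → f ⊗ one ≈ f
⊗-identityʳ f n m = begin
  (f ⊗ one) n m             ≡⟨ ⊗-comm f one n m ⟩
  (one ⊗ f) n m             ≡⟨ ⊗-cong {g = f} (δ*δ≈monomial 0 0) (λ _ _ → refl) n m ⟩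
  (monomial 1 0 0 ⊗ f) n m  ≡⟨ monomial-⊗ 1 0 0 f n m ⟩
  1 * (1 * (1 * f n m))     ≡⟨ *-identityˡ _ ⟩
  1 * (1 * f n m)           ≡⟨ *-identityˡ _ ⟩
  1 * f n m                 ≡⟨ *-identityˡ _ ⟩
  f n m                     ∎

qx^ˢ≈monomial : ∀ k → qx ^ˢ k ≈ monomial 1 k k
qx^ˢ≈monomial zero        = δ*δ≈monomial 0 0
qx^ˢ≈monomial (suc k) n m = begin
  ((qx ^ˢ k) ⊗ qx) n m                   ≡⟨ ⊗-comm (qx ^ˢ k) qx n m ⟩
  (qx ⊗ (qx ^ˢ k)) n m                   ≡⟨ ⊗-cong (δ*δ≈monomial 1 1) (qx^ˢ≈monomial k) n m ⟩
  (monomial 1 1 1 ⊗ monomial 1 k k) n m  ≡⟨ monomial-⊗-monomial 1 1 1 1 k k n m ⟩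
  monomial 1 (suc k) (suc k) n m         ∎

elementary : List ℕ → ℕ → ℕ
elementary cs       zero    = 1
elementary []       (suc j) = 0
elementary (c ∷ cs) (suc j) = elementary cs (suc j) + c * elementary cs j

elementary-∷-cong : ∀ c {xs ys} → (∀ j → elementary xs j ≡ elementary ys j) →
                    ∀ j → elementary (c ∷ xs) j ≡ elementary (c ∷ ys) j
elementary-∷-cong c xs≗ys zero    = refl
elementary-∷-cong c xs≗ys (suc j) = cong₂ (λ x y → x + c * y) (xs≗ys (suc j)) (xs≗ys j)

elementary-swap : ∀ a b cs j → elementary (a ∷ b ∷ cs) j ≡ elementary (b ∷ a ∷ cs) j
elementary-swap a b cs zero          = refl
elementary-swap a b cs (suc zero)    = swap-linear (elementary cs 1) a b
  where
  swap-linear : ∀ x a b → x + b * 1 + a * 1 ≡ x + a * 1 + b * 1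
  swap-linear = solve-∀
elementary-swap a b cs (suc (suc j)) =
  swap-quadratic (elementary cs (2 + j)) (elementary cs (suc j)) (elementary cs j) a b
  where
  swap-quadratic : ∀ x y z a b → x + b * y + a * (y + b * z) ≡ x + a * y + b * (y + a * z)
  swap-quadratic = solve-∀

elementary-↭ : ∀ {xs ys} → xs ↭ ys → ∀ j → elementary xs j ≡ elementary ys j
elementary-↭ ↭.refl               j = refl
elementary-↭ (↭.prep c xs↭ys)     j = elementary-∷-cong c (elementary-↭ xs↭ys) j
elementary-↭ (↭.swap a b xs↭ys)   j =
  trans (elementary-swap a b _ j) (elementary-∷-cong b (elementary-∷-cong a (elementary-↭ xs↭ys)) j)
elementary-↭ (↭.trans xs↭ys ys↭zs) j = trans (elementary-↭ xs↭ys j) (elementary-↭ ys↭zs j)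

elementary-0∷ : ∀ cs j → elementary (0 ∷ cs) j ≡ elementary cs j
elementary-0∷ cs zero    = refl
elementary-0∷ cs (suc j) = +-identityʳ (elementary cs (suc j))

elementary-∷-unfold : ∀ c cs n →
  elementary cs n + [ 1 ≤ n ] * (c * elementary cs (n ∸ 1)) ≡ elementary (c ∷ cs) n
elementary-∷-unfold c cs zero    = refl
elementary-∷-unfold c cs (suc n) = cong (elementary cs (suc n) +_) (*-identityˡ (c * elementary cs n))

ascending : ℕ → ℕ → List ℕ
ascending s zero    = []
ascending s (suc d) = s ∷ ascending (suc s) d

ascending-∷ʳ : ∀ s d → ascending s (suc d) ≡ ascending s d ∷ʳ (s + d)
ascending-∷ʳ s zero    = cong (_∷ []) (sym (+-identityʳ s))
ascending-∷ʳ s (suc d) =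
  cong (s ∷_) (trans (ascending-∷ʳ (suc s) d) (cong (ascending (suc s) d ∷ʳ_) (sym (+-suc s d))))

ascending↭applyDownFrom : ∀ s d → ascending s d ↭ applyDownFrom (s +_) d
ascending↭applyDownFrom s zero    = ↭.refl
ascending↭applyDownFrom s (suc d) rewrite ascending-∷ʳ s d =
  ↭-trans (↭-sym (∷↭∷ʳ (s + d) (ascending s d))) (↭-prep (s + d) (ascending↭applyDownFrom s d))

prodTerm-coeff : ∀ k → prodTerm k ≈ λ n m → δ m 0 * elementary (applyDownFrom suc k) n
prodTerm-coeff zero    zero    m = *-comm 1 (δ m 0)
prodTerm-coeff zero    (suc n) m = *-comm 0 (δ m 0)
prodTerm-coeff (suc k) n m = begin
  (prodTerm k ⊗ (one ⊕ cx (suc k))) n m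
    ≡⟨ ⊗-distribˡ-⊕ (prodTerm k) one (cx (suc k)) n m ⟩
  (prodTerm k ⊗ one) n m + (prodTerm k ⊗ cx (suc k)) n m
    ≡⟨ cong₂ _+_ (⊗-identityʳ (prodTerm k) n m)
                 (trans (⊗-comm (prodTerm k) (cx (suc k)) n m) (monomial-⊗ (suc k) 1 0 (prodTerm k) n m)) ⟩
  prodTerm k n m + [ 1 ≤ n ] * (1 * (suc k * prodTerm k (n ∸ 1) m))
    ≡⟨ cong₂ (λ x y → x + [ 1 ≤ n ] * (1 * (suc k * y))) (prodTerm-coeff k n m) (prodTerm-coeff k (n ∸ 1) m) ⟩
  δ m 0 * e n + [ 1 ≤ n ] * (1 * (suc k * (δ m 0 * e (n ∸ 1))))
    ≡⟨ factor (δ m 0) (e n) [ 1 ≤ n ] (suc k) (e (n ∸ 1)) ⟩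
  δ m 0 * (e n + [ 1 ≤ n ] * (suc k * e (n ∸ 1)))
    ≡⟨ cong (δ m 0 *_) (elementary-∷-unfold (suc k) (applyDownFrom suc k) n) ⟩
  δ m 0 * elementary (applyDownFrom suc (suc k)) n
    ∎
  where
  e : ℕ → ℕ
  e = elementary (applyDownFrom suc k)
  factor : ∀ d x b c y → d * x + b * (1 * (c * (d * y))) ≡ d * (x + b * (c * y))
  factor = solve-∀

-- The factor [ k ≤ n ] matters: for n < k, n ∸ k truncates to 0 and elementary _ 0 = 1.
Rterm-coeff : ∀ k → Rterm k ≈ λ n m → [ k ≤ n ] * (δ k m * elementary (applyDownFrom suc k) (n ∸ k))
Rterm-coeff k n m = begin
  ((qx ^ˢ k) ⊗ prodTerm k) n m
    ≡⟨ ⊗-cong {g′ = λ n m → δ m 0 * e n} (qx^ˢ≈monomial k) (prodTerm-coeff k) n m ⟩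
  (monomial 1 k k ⊗ (λ n m → δ m 0 * e n)) n m
    ≡⟨ monomial-⊗ 1 k k (λ n m → δ m 0 * e n) n m ⟩
  [ k ≤ n ] * ([ k ≤ m ] * (1 * (δ (m ∸ k) 0 * e (n ∸ k))))
    ≡⟨ cong ([ k ≤ n ] *_) (reassoc [ k ≤ m ] (δ (m ∸ k) 0) (e (n ∸ k))) ⟩
  [ k ≤ n ] * ([ k ≤ m ] * δ (m ∸ k) 0 * e (n ∸ k))
    ≡⟨ cong (λ x → [ k ≤ n ] * (x * e (n ∸ k))) ([≤]*δ-∸ k m 0) ⟩
  [ k ≤ n ] * (δ m (k + 0) * e (n ∸ k))
    ≡⟨ cong (λ x → [ k ≤ n ] * (x * e (n ∸ k))) (trans (cong (δ m) (+-identityʳ k)) (δ-sym m k)) ⟩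
  [ k ≤ n ] * (δ k m * e (n ∸ k))
    ∎
  where
  e : ℕ → ℕ
  e = elementary (applyDownFrom suc k)
  reassoc : ∀ b d x → b * (1 * (d * x)) ≡ b * d * x
  reassoc = solve-∀

r-closed : ∀ n t → r n t ≡ [ t ≤ n ] * elementary (applyDownFrom suc t) (n ∸ t)
r-closed n t = begin
  Σ≤ n (λ k → Rterm k n t)
    ≡⟨ Σ≤-cong n (λ k k≤n → trans (Rterm-coeff k n t) ([≤]*-identity k≤n _)) ⟩
  Σ≤ n (λ k → δ k t * elementary (applyDownFrom suc k) (n ∸ k))
    ≡⟨ Σ≤-δ n t (λ k → elementary (applyDownFrom suc k) (n ∸ k)) ⟩
  [ t ≤ n ] * elementary (applyDownFrom suc t) (n ∸ t)
    ∎

inR-from : ℕ → Bool → Word → Bool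
inR-from m vacant []      = true
inR-from m vacant (a ∷ w) =
  if a ≡ᵇ suc m then inR-from (suc m) true w
  else vacant ∧ (1 ≤ᵇ a) ∧ (a ≤ᵇ m) ∧ inR-from m false w

blocks-from-∷ : ∀ m w p q qs → blocks-from m w (p ∷ q ∷ qs) ≡ p ∷ blocks-from m w (q ∷ qs)
blocks-from-∷ m []      p q qs = refl
blocks-from-∷ m (a ∷ w) p q qs with a ≡ᵇ suc m
... | true  = blocks-from-∷ (suc m) w p q (qs ++ (suc m , []) ∷ [])
blocks-from-∷ m (a ∷ w) p q []      | false = blocks-from-∷ m w p _ []
blocks-from-∷ m (a ∷ w) p q (_ ∷ _) | false = blocks-from-∷ m w p q _

inR-from-blocks : ∀ m B w →
  isRGF-from m w ∧ and (map goodBlock (blocks-from m w ((m , B) ∷ [])))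
    ≡ goodBlock (m , B) ∧ inR-from m (null B) w
inR-from-blocks m B []      = refl
inR-from-blocks m B (a ∷ w) with <-cmp a (suc m)
... | tri≈ _ refl _
  rewrite dec-true (m ≟ m) refl | dec-true (suc m ≤? suc m) ≤-refl | m≤n⇒m⊔n≡n (n≤1+n m)
        | blocks-from-∷ (suc m) w (m , B) (suc m , []) []
  = trans (∧-leftComm (isRGF-from (suc m) w) (goodBlock (m , B)) _)
          (cong (goodBlock (m , B) ∧_) (inR-from-blocks (suc m) [] w))
... | tri< (s≤s a≤m) a≢1+m _
  rewrite dec-false (a ≟ suc m) a≢1+m | dec-true (a ≤? suc m) (m≤n⇒m≤1+n a≤m) | dec-true (a ≤? m) a≤m
        | m≥n⇒m⊔n≡m a≤m
  = begin
      ((1 ≤ᵇ a) ∧ isRGF-from m w) ∧ and (map goodBlock (blocks-from m w ((m , B ++ a ∷ []) ∷ [])))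
    ≡⟨ ∧-assoc (1 ≤ᵇ a) _ _ ⟩
      (1 ≤ᵇ a) ∧ (isRGF-from m w ∧ and (map goodBlock (blocks-from m w ((m , B ++ a ∷ []) ∷ []))))
    ≡⟨ cong ((1 ≤ᵇ a) ∧_) (inR-from-blocks m (B ++ a ∷ []) w) ⟩
      (1 ≤ᵇ a) ∧ (goodBlock (m , B ++ a ∷ []) ∧ inR-from m (null (B ++ a ∷ [])) w)
    ≡⟨ fill B ⟩
      goodBlock (m , B) ∧ (null B ∧ ((1 ≤ᵇ a) ∧ (true ∧ inR-from m false w)))
    ∎
  where
  fill : ∀ B → (1 ≤ᵇ a) ∧ (goodBlock (m , B ++ a ∷ []) ∧ inR-from m (null (B ++ a ∷ [])) w)
             ≡ goodBlock (m , B) ∧ (null B ∧ ((1 ≤ᵇ a) ∧ (true ∧ inR-from m false w)))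
  fill []          rewrite dec-true (a ≤? m) a≤m = refl
  fill (b ∷ [])    = trans (∧-zeroʳ (1 ≤ᵇ a)) (sym (∧-zeroʳ (b ≤ᵇ m)))
  fill (_ ∷ _ ∷ _) = ∧-zeroʳ (1 ≤ᵇ a)
... | tri> _ a≢1+m 1+m<a
  rewrite dec-false (a ≟ suc m) a≢1+m | dec-false (a ≤? suc m) (<⇒≱ 1+m<a)
        | dec-false (a ≤? m) (<⇒≱ (<-trans (n<1+n m) 1+m<a))
        | ∧-zeroʳ (1 ≤ᵇ a) | ∧-zeroʳ (null B) | ∧-zeroʳ (goodBlock (m , B))
  = refl

inR≡inR-from : ∀ α → inR α ≡ inR-from 0 true α
inR≡inR-from []                = refl
inR≡inR-from (zero ∷ w)        = refl
inR≡inR-from (suc zero ∷ w)    = inR-from-blocks 1 [] w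
inR≡inR-from (suc (suc a) ∷ w) = refl

sum-applyUpTo : ∀ (f : ℕ → ℕ) k → sum (applyUpTo f (suc k)) ≡ Σ≤ k f
sum-applyUpTo f zero    = +-identityʳ (f 0)
sum-applyUpTo f (suc k) = trans (cong (f 0 +_) (sum-applyUpTo (f ∘ suc) k)) (sym (Σ≤-suc k f))

sum-map-+ : ∀ {A : Set} (f g : A → ℕ) xs →
            sum (map (λ x → f x + g x) xs) ≡ sum (map f xs) + sum (map g xs)
sum-map-+ f g []       = refl
sum-map-+ f g (x ∷ xs) rewrite sum-map-+ f g xs =
  +-interchange (f x) (g x) (sum (map f xs)) (sum (map g xs))

sum-map-*ˡ : ∀ {A : Set} c (f : A → ℕ) xs → sum (map (λ x → c * f x) xs) ≡ c * sum (map f xs)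
sum-map-*ˡ c f []       = sym (*-zeroʳ c)
sum-map-*ˡ c f (x ∷ xs) rewrite sum-map-*ˡ c f xs = sym (*-distribˡ-+ c (f x) (sum (map f xs)))

sum-map-concatMap : ∀ {A B : Set} (f : B → ℕ) (g : A → List B) xs →
                    sum (map f (concatMap g xs)) ≡ sum (map (λ x → sum (map f (g x))) xs)
sum-map-concatMap f g []       = refl
sum-map-concatMap f g (x ∷ xs) = begin
  sum (map f (g x ++ concatMap g xs))
    ≡⟨ cong sum (map-++ f (g x) (concatMap g xs)) ⟩
  sum (map f (g x) ++ map f (concatMap g xs))
    ≡⟨ sum-++ (map f (g x)) (map f (concatMap g xs)) ⟩
  sum (map f (g x)) + sum (map f (concatMap g xs))
    ≡⟨ cong (sum (map f (g x)) +_) (sum-map-concatMap f g xs) ⟩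
  sum (map f (g x)) + sum (map (λ x → sum (map f (g x))) xs)
    ∎

sum-map-filter : ∀ {A : Set} (P : A → Bool) (f : A → ℕ) xs →
  sum (map f (filter (λ x → T? (P x)) xs)) ≡ sum (map (λ x → if P x then f x else 0) xs)
sum-map-filter P f []       = refl
sum-map-filter P f (x ∷ xs) with P x
... | true  = cong (f x +_) (sum-map-filter P f xs)
... | false = sum-map-filter P f xs

sum-wordsOver-suc : ∀ (f : Word → ℕ) k n →
  sum (map f (wordsOver (suc k) (suc n)))
    ≡ Σ≤ k (λ b → sum (map (λ w → f (suc b ∷ w)) (wordsOver (suc k) n)))
sum-wordsOver-suc f k n = begin
  sum (map f (concatMap (λ a → map (a ∷_) ws) (map suc (upTo (suc k)))))
    ≡⟨ sum-map-concatMap f (λ a → map (a ∷_) ws) (map suc (upTo (suc k))) ⟩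
  sum (map F (map suc (upTo (suc k))))
    ≡⟨ cong (sum ∘ map F) (map-upTo suc (suc k)) ⟩
  sum (map F (applyUpTo suc (suc k)))
    ≡⟨ cong sum (map-applyUpTo suc F (suc k)) ⟩
  sum (applyUpTo (F ∘ suc) (suc k))
    ≡⟨ sum-applyUpTo (F ∘ suc) k ⟩
  Σ≤ k (F ∘ suc)
    ≡⟨ Σ≤-cong k (λ b _ → cong sum (sym (map-∘ ws))) ⟩
  Σ≤ k (λ b → sum (map (λ w → f (suc b ∷ w)) ws))
    ∎
  where
  ws = wordsOver (suc k) n
  F : ℕ → ℕ
  F a = sum (map f (map (a ∷_) ws))

weight : ℕ → Bool → ℕ → Word → ℕ
weight m vacant t w = if inR-from m vacant w then δ (m ⊔ maxW w) t else 0

accepted : ℕ → ℕ → ℕ → Bool → ℕ → ℕ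
accepted k n m vacant t = sum (map (weight m vacant t) (wordsOver k n))

weight-new : ∀ m vacant t w → weight m vacant t (suc m ∷ w) ≡ weight (suc m) true t w
weight-new m vacant t w
  rewrite dec-true (m ≟ m) refl | sym (⊔-assoc m (suc m) (maxW w)) | m≤n⇒m⊔n≡n (n≤1+n m) = refl

weight-∷-filled : ∀ m t b w → weight m false t (suc b ∷ w) ≡ δ b m * weight (suc m) true t w
weight-∷-filled m t b w with b ≟ m
... | yes refl rewrite δ-refl b = trans (weight-new b false t w) (sym (+-identityʳ _))
... | no b≢m   rewrite dec-false (b ≟ m) b≢m = refl

weight-∷-vacant : ∀ m t b w →
  weight m true t (suc b ∷ w) ≡ δ b m * weight (suc m) true t w + [ suc b ≤ m ] * weight m false t w
weight-∷-vacant m t b w with <-cmp b m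
... | tri< b<m b≢m _
  rewrite dec-false (b ≟ m) b≢m | dec-true (suc b ≤? m) b<m | [≤]≡1 b<m
        | sym (⊔-assoc m (suc b) (maxW w)) | m≥n⇒m⊔n≡m b<m
  = sym (+-identityʳ _)
... | tri≈ _ refl _ rewrite δ-refl b | [≤]≡0 (n<1+n b) =
  trans (weight-new b true t w) (sym (trans (+-identityʳ _) (+-identityʳ _)))
... | tri> _ b≢m m<b
  rewrite dec-false (b ≟ m) b≢m | dec-false (suc b ≤? m) (<⇒≱ (m<n⇒m<1+n m<b)) | [≤]≡0 (m<n⇒m<1+n m<b)
  = refl

accepted-filled : ∀ k n m t → m < k → accepted k (suc n) m false t ≡ accepted k n (suc m) true t
accepted-filled (suc k) n m t (s≤s m≤k) = begin
  accepted (suc k) (suc n) m false t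
    ≡⟨ sum-wordsOver-suc (weight m false t) k n ⟩
  Σ≤ k (λ b → sum (map (λ w → weight m false t (suc b ∷ w)) ws))
    ≡⟨ Σ≤-cong k (λ b _ → trans (cong sum (map-cong (weight-∷-filled m t b) ws)) (sum-map-*ˡ (δ b m) _ ws)) ⟩
  Σ≤ k (λ b → δ b m * A)
    ≡⟨ Σ≤-δ k m (λ _ → A) ⟩
  [ m ≤ k ] * A
    ≡⟨ [≤]*-identity m≤k A ⟩
  A ∎
  where
  ws = wordsOver (suc k) n
  A = accepted (suc k) n (suc m) true t

accepted-vacant : ∀ k n m t → m < k →
  accepted k (suc n) m true t ≡ accepted k n (suc m) true t + m * accepted k n m false t
accepted-vacant (suc k) n m t (s≤s m≤k) = begin
  accepted (suc k) (suc n) m true t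
    ≡⟨ sum-wordsOver-suc (weight m true t) k n ⟩
  Σ≤ k (λ b → sum (map (λ w → weight m true t (suc b ∷ w)) ws))
    ≡⟨ Σ≤-cong k (λ b _ → trans (cong sum (map-cong (weight-∷-vacant m t b) ws)) (linear b)) ⟩
  Σ≤ k (λ b → δ b m * A + [ suc b ≤ m ] * B)
    ≡⟨ Σ≤-+ k _ _ ⟩
  Σ≤ k (λ b → δ b m * A) + Σ≤ k (λ b → [ suc b ≤ m ] * B)
    ≡⟨ cong₂ _+_ (Σ≤-δ k m (λ _ → A)) (Σ≤-below k m B (m≤n⇒m≤1+n m≤k)) ⟩
  [ m ≤ k ] * A + m * B
    ≡⟨ cong (_+ m * B) ([≤]*-identity m≤k A) ⟩
  A + m * B ∎
  where
  ws = wordsOver (suc k) n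
  A = accepted (suc k) n (suc m) true t
  B = accepted (suc k) n m false t
  linear : ∀ b → sum (map (λ w → δ b m * weight (suc m) true t w + [ suc b ≤ m ] * weight m false t w) ws)
               ≡ δ b m * A + [ suc b ≤ m ] * B
  linear b = trans (sum-map-+ _ _ ws)
                   (cong₂ _+_ (sum-map-*ˡ (δ b m) _ ws) (sum-map-*ˡ [ suc b ≤ m ] _ ws))

count : ℕ → ℕ → Bool → ℕ → ℕ
count zero    m vacant t = δ m t
count (suc n) m false  t = count n (suc m) true t
count (suc n) m true   t = count n (suc m) true t + m * count n m false t

accepted≡count : ∀ k n m vacant t → m + n ≤ k → accepted k n m vacant t ≡ count n m vacant t
accepted≡count k zero    m vacant t _ = trans (+-identityʳ _) (cong (λ x → δ x t) (⊔-identityʳ m))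
accepted≡count k (suc n) m vacant t m+[1+n]≤k = step vacant
  where
  m+1+n≤k : suc m + n ≤ k
  m+1+n≤k = subst (_≤ k) (+-suc m n) m+[1+n]≤k
  m<k : m < k
  m<k = ≤-trans (m≤m+n (suc m) n) m+1+n≤k
  m+n≤k : m + n ≤ k
  m+n≤k = ≤-trans (+-monoʳ-≤ m (n≤1+n n)) m+[1+n]≤k
  step : ∀ vacant → accepted k (suc n) m vacant t ≡ count (suc n) m vacant t
  step false = trans (accepted-filled k n m t m<k) (accepted≡count k n (suc m) true t m+1+n≤k)
  step true  = trans (accepted-vacant k n m t m<k)
    (cong₂ (λ x y → x + m * y) (accepted≡count k n (suc m) true t m+1+n≤k)
                               (accepted≡count k n m false t m+n≤k))

count-below : ∀ n m vacant t → t < m → count n m vacant t ≡ 0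
count-below zero    m vacant t t<m = δ-≢ (≢-sym (<⇒≢ t<m))
count-below (suc n) m false  t t<m = count-below n (suc m) true t (m<n⇒m<1+n t<m)
count-below (suc n) m true   t t<m
  rewrite count-below n (suc m) true t (m<n⇒m<1+n t<m) | count-below n m false t t<m = *-zeroʳ m

count-above : ∀ n m vacant t → m + n < t → count n m vacant t ≡ 0
count-above zero    m vacant t m+0<t = δ-≢ (<⇒≢ (subst (_< t) (+-identityʳ m) m+0<t))
count-above (suc n) m false  t m+[1+n]<t =
  count-above n (suc m) true t (subst (_< t) (+-suc m n) m+[1+n]<t)
count-above (suc n) m true   t m+[1+n]<t
  rewrite count-above n (suc m) true t (subst (_< t) (+-suc m n) m+[1+n]<t)
        | count-above n m false t (≤-<-trans (+-monoʳ-≤ m (n≤1+n n)) m+[1+n]<t) = *-zeroʳ m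

-- From state m the blocks B_(m+1), …, B_(m+d) are opened, and j of the blocks that are
-- still vacant receive a letter, B_i offering i letters.
count-filled : ∀ m d j → count (j + d) m false (m + d) ≡ elementary (ascending (suc m) d) j
count-vacant : ∀ m d j → count (j + d) m true  (m + d) ≡ elementary (ascending m (suc d)) j

count-filled m zero    zero    = trans (cong (δ m) (+-identityʳ m)) (δ-refl m)
count-filled m zero    (suc j) = count-below (j + 0) (suc m) true (m + 0) (s≤s (≤-reflexive (+-identityʳ m)))
count-filled m (suc d) j rewrite +-suc j d | +-suc m d = count-vacant (suc m) d j

count-vacant m zero    zero    = trans (cong (δ m) (+-identityʳ m)) (δ-refl m)
count-vacant m (suc d) zero
  rewrite count-filled m (suc d) 0 | count-above d m false (m + suc d) (+-monoʳ-< m (n<1+n d)) | *-zeroʳ m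
  = refl
count-vacant m d       (suc j) = cong₂ (λ x y → x + m * y) (count-filled m d (suc j)) (count-filled m d j)

count-closed : ∀ n t → count n 0 true t ≡ [ t ≤ n ] * elementary (applyDownFrom suc t) (n ∸ t)
count-closed n t with t ≤? n
... | yes t≤n = begin
  count n 0 true t                          ≡⟨ cong (λ n → count n 0 true t) (m∸n+n≡m t≤n) ⟨
  count (n ∸ t + t) 0 true t                ≡⟨ count-vacant 0 t (n ∸ t) ⟩
  elementary (0 ∷ ascending 1 t) (n ∸ t)    ≡⟨ elementary-0∷ (ascending 1 t) (n ∸ t) ⟩
  elementary (ascending 1 t) (n ∸ t)        ≡⟨ elementary-↭ (ascending↭applyDownFrom 1 t) (n ∸ t) ⟩
  elementary (applyDownFrom suc t) (n ∸ t)  ≡⟨ [≤]*-identity t≤n _ ⟨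
  [ t ≤ n ] * elementary (applyDownFrom suc t) (n ∸ t)
    ∎
... | no t≰n rewrite [≤]≡0 (≰⇒> t≰n) = count-above n 0 true t (≰⇒> t≰n)

rhs≡accepted : ∀ n t → rhs n t ≡ accepted n n 0 true t
rhs≡accepted n t = trans (sum-map-filter inR (λ α → δ (maxW α) t) (wordsOver n n))
  (cong sum (map-cong (λ α → cong (λ b → if b then δ (maxW α) t else 0) (inR≡inR-from α)) (wordsOver n n)))

lemma4p6 : (n m : ℕ) → r n m ≡ rhs n m
lemma4p6 n m = begin
  r n m                                                 ≡⟨ r-closed n m ⟩
  [ m ≤ n ] * elementary (applyDownFrom suc m) (n ∸ m)  ≡⟨ count-closed n m ⟨
  count n 0 true m                                      ≡⟨ accepted≡count n n 0 true m ≤-refl ⟨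
  accepted n n 0 true m                                 ≡⟨ rhs≡accepted n m ⟨
  rhs n m                                               ∎
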